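{- Let $M_1,M_2$ be MSO graph-to-string transducers (possibly nondeterministic) with the same input graph alphabet, and let $a,b$ be distinct symbols. There exists (effectively) an MSO graph-to-dgraph transducer $M^{a,b}$ such that for every graph $g$, \[ M^{a,b}(g)=\{{\rm dgr}(a^mb^n)\mid m,n\ge1,\ \exists h_1\in M_1(g),\ h_2\in M_2(g):\ h_1/m=a\text{ and }h_2/n=b\}. \]
   Context: A graph over a graph alphabet $(\Sigma,\Gamma)$ (node labels $\Sigma$, edge labels $\Gamma$) is a tuple $(V,E,\lambda)$ with $V$ a finite set of nodes, $E\subseteq V\times\Gamma\times V$ and $\lambda:V\to\Sigma$. MSO formulas over $(\Sigma,\Gamma)$ use node variables and node-set variables (quantifiable), and atomic formulas ${\rm lab}_\sigma(x)$, ${\rm edg}_\gamma(x,y)$, $x\in X$. An MSO graph transducer from $(\Sigma_1,\Gamma_1)$ to $(\Sigma_2,\Gamma_2)$ is a tuple $(C,\varphi_{\rm dom},\Psi,X)$ with $C$ a finite set of copy names, all formulas MSO over $(\Sigma_1,\Gamma_1)$ that may additionally have fixed free node-set variables $Y_1,\dots,Y_k$ (parameters): a domain formula $\varphi_{\rm dom}$ (free variables only the parameters), node formulas $\psi_{c,\sigma}(x)$ for $c\in C,\sigma\in\Sigma_2$, and edge formulas $\chi_{c,c',\gamma}(x,y)$ for $c,c'\in C,\gamma\in\Gamma_2$. For an input graph $g$ and each valuation of the parameters by node sets of $g$ satisfying $\varphi_{\rm dom}$, an output graph $h$ is defined: $V_h$ is the set of pairs $(c,u)$ such that exactly one $\sigma\in\Sigma_2$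 has $(g,u)\models\psi_{c,\sigma}$; $(c,u)$ gets that label $\sigma$; and there is a $\gamma$-edge from $(c,u)$ to $(c',u')$ iff $(g,u,u')\models\chi_{c,c',\gamma}$. $M(g)$ is the set of all output graphs for $g$. A transducer is graph-to-string (resp. graph-to-dgraph) if all its output graphs are strings (resp. discrete graphs). A string $w=a_1\cdots a_n$ over $\Delta$ is identified with the graph over $(\{\#\},\Delta)$ with $\#$-labeled nodes $v_1,\dots,v_{n+1}$ and an $a_i$-labeled edge from $v_i$ to $v_{i+1}$ for $1\le i\le n$; $w/i$ denotes the $i$-th letter $a_i$. A discrete graph (dgraph) is a graph without edges; ${\rm dgr}(w)$ is the dgraph having, for each symbol $\sigma$, as many $\sigma$-labeled nodes as there are occurrences of $\sigma$ in $w$. Graphs are compared up to isomorphism. -}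

module Defs where

open import Data.Nat using (ℕ; zero; suc; _≡ᵇ_; _+_; _≥_)
open import Data.Bool using (Bool; true; false; _∧_; _∨_; not; T)
open import Data.Fin using (Fin; toℕ) renaming (zero to fz; suc to fs)
open import Data.List using (List; []; _∷_; length; replicate; _++_; lookup)
open import Data.Maybe using (Maybe; just; nothing)
open import Data.Product using (Σ; _×_; _,_; ∃; proj₁)
open import Data.Vec.Functional using () renaming (_∷_ to _∷ᶠ_; [] to []ᶠ)
open import Function.Bundles using (_↔_; Inverse)
open import Relation.Binary.PropositionalEquality using (_≡_; _≢_)
open import Relation.Nullary.Decidable using (⌊_⌋)
import Data.Fin as F

-- Graph alphabets are (number of node labels, number of edge labels);
-- node labels are Fin σ, edge labels are Fin γ.
-- A graph has nodes Fin size, a labelling, and a (decidable) edge relation.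

record Graph (σ γ : ℕ) : Set where
  field
    size : ℕ
    lab  : Fin size → Fin σ
    edge : Fin size → Fin γ → Fin size → Bool
open Graph public

record _≅_ {σ γ : ℕ} (g h : Graph σ γ) : Set where
  field
    bij       : Fin (size g) ↔ Fin (size h)
  open Inverse bij public using (to)
  field
    lab-pres  : ∀ u → lab h (to u) ≡ lab g u
    edge-pres : ∀ u t v → edge h (to u) t (to v) ≡ edge g u t v

-- MSO formulas over (σ, γ) with i node variables and j node-set
-- variables in scope (de Bruijn indices).

data Formula (σ γ : ℕ) : ℕ → ℕ → Set where
  labF : ∀ {i j} → Fin σ → Fin i → Formula σ γ i j
  edgF : ∀ {i j} → Fin γ → Fin i → Fin i → Formula σ γ i j
  memF : ∀ {i j} → Fin i → Fin j → Formula σ γ i j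
  ¬'   : ∀ {i j} → Formula σ γ i j → Formula σ γ i j
  _∧'_ : ∀ {i j} → Formula σ γ i j → Formula σ γ i j → Formula σ γ i j
  _∨'_ : ∀ {i j} → Formula σ γ i j → Formula σ γ i j → Formula σ γ i j
  ∃ₙ   : ∀ {i j} → Formula σ γ (suc i) j → Formula σ γ i j
  ∃ₛ   : ∀ {i j} → Formula σ γ i (suc j) → Formula σ γ i j

anyFin : (n : ℕ) → (Fin n → Bool) → Bool
anyFin zero    P = false
anyFin (suc n) P = P fz ∨ anyFin n (λ u → P (fs u))

anySubset : (n : ℕ) → ((Fin n → Bool) → Bool) → Bool
anySubset zero    P = P (λ ())
anySubset (suc n) P =
  anySubset n (λ S → P (false ∷ᶠ S)) ∨ anySubset n (λ S → P (true ∷ᶠ S))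

eval : ∀ {σ γ i j} → Formula σ γ i j → (g : Graph σ γ) →
       (Fin i → Fin (size g)) → (Fin j → Fin (size g) → Bool) → Bool
eval (labF s x)   g ρ η = ⌊ lab g (ρ x) F.≟ s ⌋
eval (edgF t x y) g ρ η = edge g (ρ x) t (ρ y)
eval (memF x X) g ρ η = η X (ρ x)
eval (¬' φ)      g ρ η = not (eval φ g ρ η)
eval (φ ∧' ψ)    g ρ η = eval φ g ρ η ∧ eval ψ g ρ η
eval (φ ∨' ψ)    g ρ η = eval φ g ρ η ∨ eval ψ g ρ η
eval (∃ₙ φ)      g ρ η = anyFin (size g) (λ u → eval φ g (u ∷ᶠ ρ) η)
eval (∃ₛ φ)      g ρ η = anySubset (size g) (λ S → eval φ g ρ (S ∷ᶠ η))

-- MSO graph transducers from (σ₁,γ₁) to (σ₂,γ₂).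
-- copies : number of copy names (C = Fin copies),
-- params : number of parameters Y₁..Y_k (free set variables).

record Transducer (σ₁ γ₁ σ₂ γ₂ : ℕ) : Set where
  field
    copies : ℕ
    params : ℕ
    dom    : Formula σ₁ γ₁ 0 params
    node   : Fin copies → Fin σ₂ → Formula σ₁ γ₁ 1 params
    edgeF  : Fin copies → Fin copies → Fin γ₂ → Formula σ₁ γ₁ 2 params
open Transducer public

b2n : Bool → ℕ
b2n true  = 1
b2n false = 0

count : (n : ℕ) → (Fin n → Bool) → ℕ
count zero    P = 0
count (suc n) P = b2n (P fz) + count n (λ u → P (fs u))

module _ {σ₁ γ₁ σ₂ γ₂ : ℕ} (M : Transducer σ₁ γ₁ σ₂ γ₂) (g : Graph σ₁ γ₁)
         (Y : Fin (params M) → Fin (size g) → Bool) where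

  nodeHolds : Fin (copies M) → Fin (size g) → Fin σ₂ → Bool
  nodeHolds c u s = eval (node M c s) g (u ∷ᶠ []ᶠ) Y

  isOutNode : Fin (copies M) × Fin (size g) → Bool
  isOutNode (c , u) = count σ₂ (nodeHolds c u) ≡ᵇ 1

  OutNode : Set
  OutNode = Σ (Fin (copies M) × Fin (size g)) (λ p → T (isOutNode p))

  record IsOutput (h : Graph σ₂ γ₂) : Set where
    field
      bij       : Fin (size h) ↔ OutNode
    open Inverse bij public using (to)
    field
      lab-pres  : ∀ v → let ((c , u) , _) = to v in T (nodeHolds c u (lab h v))
      edge-pres : ∀ v t w → let ((c , u) , _) = to v ; ((c' , u') , _) = to w in
                  edge h v t w ≡ eval (edgeF M c c' t) g (u ∷ᶠ u' ∷ᶠ []ᶠ) Y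

_∈⟦_⟧_ : ∀ {σ₁ γ₁ σ₂ γ₂} → Graph σ₂ γ₂ → Transducer σ₁ γ₁ σ₂ γ₂ → Graph σ₁ γ₁ → Set
h ∈⟦ M ⟧ g = Σ (Fin (params M) → Fin (size g) → Bool)
               (λ Y → T (eval (dom M) g (λ ()) Y) × IsOutput M g Y h)

-- the string w = a₁⋯aₙ over Δ = Fin d as a graph over ({#}, Δ), # = the unique label
letterAt : ∀ {d} → List (Fin d) → ℕ → Fin d → Bool
letterAt []       _       a = false
letterAt (x ∷ w)  zero    a = ⌊ x F.≟ a ⌋
letterAt (x ∷ w)  (suc i) a = letterAt w i a

strGraph : ∀ {d} → List (Fin d) → Graph 1 d
strGraph w = record
  { size = suc (length w)
  ; lab  = λ _ → fz
  ; edge = λ u a v → (toℕ v ≡ᵇ suc (toℕ u)) ∧ letterAt w (toℕ u) a }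

IsString : ∀ {d} → Graph 1 d → Set
IsString h = ∃ λ w → h ≅ strGraph w

-- w / i : the i-th letter (1-indexed), nothing if out of range
_/_ : ∀ {A : Set} → List A → ℕ → Maybe A
[]      / _             = nothing
(x ∷ w) / zero          = nothing
(x ∷ w) / suc zero      = just x
(x ∷ w) / suc (suc i)   = w / suc i

StrLetter : ∀ {d} → Graph 1 d → ℕ → Fin d → Set
StrLetter h i a = ∃ λ w → h ≅ strGraph w × w / i ≡ just a

IsDGraph : ∀ {σ γ} → Graph σ γ → Set
IsDGraph h = ∀ u t v → edge h u t v ≡ false

dgr : ∀ {d γ} → List (Fin d) → Graph d γ
dgr w = record { size = length w ; lab = lookup w ; edge = λ _ _ _ → false }

GraphToString : ∀ {σ₁ γ₁ d} → Transducer σ₁ γ₁ 1 d → Set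
GraphToString M = ∀ g h → h ∈⟦ M ⟧ g → IsString h

GraphToDGraph : ∀ {σ₁ γ₁ σ₂ γ₂} → Transducer σ₁ γ₁ σ₂ γ₂ → Set
GraphToDGraph M = ∀ g h → h ∈⟦ M ⟧ g → IsDGraph h

{-# OPTIONS --safe #-}
-- Mᵃᵇ guesses valuations Y₁, Y₂ of the parameters of M₁, M₂ together with sets S₁, S₂ of
-- (copy, node) pairs. Its domain formula asks that Yᵢ satisfy the domain formula of Mᵢ and that
-- Sᵢ be a cut of the output string of Mᵢ: a set of output nodes closed under predecessors and
-- left by an edge labelled a (for S₁) or b (for S₂). This is MSO because the output nodes and
-- edges of Mᵢ are MSO-defined on the input. In a string w the cuts left by an a-edge are exactly
-- the prefixes v₁ ⋯ v_m with w / m = a, so S₁ has m and S₂ has n elements. Mᵃᵇ turns each pair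
-- of S₁ into an a-labelled node and each pair of S₂ into a b-labelled node and adds no edges,
-- which yields dgr (aᵐ bⁿ). Conversely, the prefixes of lengths m and n of strings h₁ ∈ M₁(g),
-- h₂ ∈ M₂(g) with h₁ / m = a and h₂ / n = b are a valid guess.
module Submission where

open import Defs
open import Data.Bool using (Bool; true; false; _∧_; _∨_; not; T; if_then_else_)
open import Data.Bool.Properties using (T-∧; T-∨; T-not-≡; T-irrelevant)
open import Data.Fin using (Fin; _≟_; toℕ; splitAt; join; _↑ˡ_; _↑ʳ_; inject₁; fromℕ<; inject≤; cast; lift)
  renaming (zero to fz; suc to fs)
open import Data.Fin.Properties using (toℕ-injective; toℕ-inject₁; toℕ-fromℕ<; toℕ-inject≤; toℕ<n;
  +↔⊎; *↔×; 0↔⊥; 1↔⊤; cast-involutive; cast-is-id;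
  join-splitAt; splitAt-join) renaming (suc-injective to fs-injective)
open import Data.Fin.Induction using (<-weakInduction)
open import Data.Fin.Patterns using (0F; 1F)
open import Data.List using (List; []; _∷_; length; lookup; replicate; _++_)
open import Data.List.Properties using (length-++; length-replicate; lookup-replicate)
open import Data.Maybe using (just)
open import Data.Maybe.Properties using (just-injective)
open import Data.Nat using (ℕ; zero; suc; _≡ᵇ_; _+_; _*_; _≤_; _<_; _≥_; _<ᵇ_; z≤n; s≤s)
open import Data.Nat.Properties using (+-identityʳ; <ᵇ⇒<; <⇒<ᵇ; ≡ᵇ⇒≡; ≡⇒≡ᵇ; suc-injective;
  ≤-reflexive; ≤-pred; ≤-trans; n≤1+n;
  m≤n⇒m<n∨m≡n; <-irrefl; <-trans; _≤?_; ≰⇒>)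
open import Data.Product using (Σ; _×_; _,_; ∃; ∃₂; proj₁; proj₂; uncurry; curry; map₁)
open import Data.Sum using (_⊎_; inj₁; inj₂; [_,_]′)
open import Data.Sum.Function.Propositional using (_⊎-cong_)
open import Data.Unit using (tt)
open import Data.Vec.Functional using () renaming (_∷_ to _∷ᶠ_; [] to []ᶠ; _++_ to _++ᶠ_)
open import Data.Vec.Functional.Properties using (lookup-++ˡ; lookup-++ʳ)
open import Function using (_∘_; const; id)
open import Function.Bundles using (_⇔_; _↔_; mk⇔; mk↔ₛ′; Equivalence; Inverse)
open import Function.Properties.Inverse using (↔-sym; ↔-trans)
open import Relation.Binary.PropositionalEquality
  using (_≡_; _≢_; refl; sym; trans; cong; cong₂; cong-app; subst; _≗_; module ≡-Reasoning)
open import Relation.Nullary using (¬_; yes; no; contradiction)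
open import Relation.Nullary.Decidable using (⌊_⌋; toWitness; fromWitness; decidable-stable; T?)

private
  module ⇔ = Equivalence
  module ↔ = Inverse

  variable
    σ γ σ₁ γ₁ d i j : ℕ


-- Booleans and finite quantifiers

T-not : ∀ {b} → T (not b) ⇔ (¬ T b)
T-not {true}  = mk⇔ (λ ()) (λ ¬t → ¬t tt)
T-not {false} = mk⇔ (λ _ ()) (λ _ → tt)

T-⇒ : ∀ {a b} → T (not a ∨ b) ⇔ (T a → T b)
T-⇒ {true}  = mk⇔ const (λ f → f tt)
T-⇒ {false} = mk⇔ (λ _ ()) (λ _ → tt)

T-anyFin : ∀ n {P : Fin n → Bool} → T (anyFin n P) ⇔ ∃ (T ∘ P)
T-anyFin zero = mk⇔ (λ ()) (λ ())
T-anyFin (suc n) {P} = mk⇔ to from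
  where
  to : T (anyFin (suc n) P) → ∃ (T ∘ P)
  to p with ⇔.to T-∨ p
  ... | inj₁ p₀ = fz , p₀
  ... | inj₂ q  = let (k , pₖ) = ⇔.to (T-anyFin n) q in fs k , pₖ
  from : ∃ (T ∘ P) → T (anyFin (suc n) P)
  from (fz   , p) = ⇔.from T-∨ (inj₁ p)
  from (fs k , p) = ⇔.from T-∨ (inj₂ (⇔.from (T-anyFin n) (k , p)))

T-allFin : ∀ n {P : Fin n → Bool} → T (not (anyFin n (not ∘ P))) ⇔ (∀ k → T (P k))
T-allFin n {P} = mk⇔
  (λ p k → decidable-stable (T? (P k)) λ ¬Pk →
     ⇔.to T-not p (⇔.from (T-anyFin n) (k , ⇔.from T-not ¬Pk)))
  (λ f → ⇔.from T-not λ q → let (k , ¬Pk) = ⇔.to (T-anyFin n) q in ⇔.to T-not ¬Pk (f k))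

anySubset-witness : ∀ n {P : (Fin n → Bool) → Bool} → T (anySubset n P) → ∃ (T ∘ P)
anySubset-witness zero p = _ , p
anySubset-witness (suc n) p with ⇔.to T-∨ p
... | inj₁ q = let (S , r) = anySubset-witness n q in false ∷ᶠ S , r
... | inj₂ q = let (S , r) = anySubset-witness n q in true ∷ᶠ S , r

anyFin-cong : ∀ n {P Q : Fin n → Bool} → P ≗ Q → anyFin n P ≡ anyFin n Q
anyFin-cong zero    e = refl
anyFin-cong (suc n) e = cong₂ _∨_ (e fz) (anyFin-cong n (e ∘ fs))

anySubset-cong : ∀ n {P Q : (Fin n → Bool) → Bool} → P ≗ Q → anySubset n P ≡ anySubset n Q
anySubset-cong zero    e = e _
anySubset-cong (suc n) e =
  cong₂ _∨_ (anySubset-cong n (e ∘ (false ∷ᶠ_))) (anySubset-cong n (e ∘ (true ∷ᶠ_)))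

b2n≡ᵇ1 : ∀ b → (b2n b ≡ᵇ 1) ≡ b
b2n≡ᵇ1 true  = refl
b2n≡ᵇ1 false = refl

whenT : (b : Bool) → (T b → Bool) → Bool
whenT true  f = f tt
whenT false f = false

whenT-T : ∀ b {f} → T (whenT b f) → T b
whenT-T true _ = tt

whenT-≡ : ∀ b {f} (p : T b) → whenT b f ≡ f p
whenT-≡ true _ = refl


-- MSO formulas

ren : ∀ {i′ j′} → (Fin i → Fin i′) → (Fin j → Fin j′) → Formula σ γ i j → Formula σ γ i′ j′
ren f r (labF s x)   = labF s (f x)
ren f r (edgF t x y) = edgF t (f x) (f y)
ren f r (memF x X)   = memF (f x) (r X)
ren f r (¬' φ)       = ¬' (ren f r φ)
ren f r (φ ∧' ψ)     = ren f r φ ∧' ren f r ψ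
ren f r (φ ∨' ψ)     = ren f r φ ∨' ren f r ψ
ren f r (∃ₙ φ)       = ∃ₙ (ren (lift 1 f) r φ)
ren f r (∃ₛ φ)       = ∃ₛ (ren f (lift 1 r) φ)

eval-ren : ∀ {i′ j′} (φ : Formula σ γ i j) (g : Graph σ γ)
  (f : Fin i → Fin i′) (r : Fin j → Fin j′) {ρ ρ′ η η′} →
  (∀ x → ρ (f x) ≡ ρ′ x) → (∀ X u → η (r X) u ≡ η′ X u) →
  eval (ren f r φ) g ρ η ≡ eval φ g ρ′ η′
eval-ren (labF s x)   g f r eρ eη = cong (λ u → ⌊ lab g u ≟ s ⌋) (eρ x)
eval-ren (edgF t x y) g f r eρ eη = cong₂ (λ u v → edge g u t v) (eρ x) (eρ y)
eval-ren (memF x X)   g f r {ρ} {η′ = η′} eρ eη = trans (eη X (ρ (f x))) (cong (η′ X) (eρ x))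
eval-ren (¬' φ)       g f r eρ eη = cong not (eval-ren φ g f r eρ eη)
eval-ren (φ ∧' ψ)     g f r eρ eη = cong₂ _∧_ (eval-ren φ g f r eρ eη) (eval-ren ψ g f r eρ eη)
eval-ren (φ ∨' ψ)     g f r eρ eη = cong₂ _∨_ (eval-ren φ g f r eρ eη) (eval-ren ψ g f r eρ eη)
eval-ren (∃ₙ φ)       g f r {ρ} {ρ′} eρ eη = anyFin-cong (size g) λ u →
  eval-ren φ g (lift 1 f) r {u ∷ᶠ ρ} {u ∷ᶠ ρ′} (λ { fz → refl ; (fs x) → eρ x }) eη
eval-ren (∃ₛ φ)       g f r {η = η} {η′} eρ eη = anySubset-cong (size g) λ S →
  eval-ren φ g f (lift 1 r) {η = S ∷ᶠ η} {S ∷ᶠ η′} eρ (λ { fz u → refl ; (fs X) u → eη X u })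

-- The syntax has no constant false and may have no variable in scope.
⊥' : Formula σ γ i j
⊥' = ∃ₛ (∃ₙ (memF 0F 0F ∧' ¬' (memF 0F 0F)))

_⇒'_ : Formula σ γ i j → Formula σ γ i j → Formula σ γ i j
φ ⇒' ψ = ¬' φ ∨' ψ

∀ₙ : Formula σ γ (suc i) j → Formula σ γ i j
∀ₙ φ = ¬' (∃ₙ (¬' φ))

⋁' : ∀ n → (Fin n → Formula σ γ i j) → Formula σ γ i j
⋁' zero    F = ⊥'
⋁' (suc n) F = F fz ∨' ⋁' n (F ∘ fs)

⋀' : ∀ n → (Fin n → Formula σ γ i j) → Formula σ γ i j
⋀' n F = ¬' (⋁' n (¬' ∘ F))

module _ (g : Graph σ γ) {ρ : Fin i → Fin (size g)} {η : Fin j → Fin (size g) → Bool} where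

  ¬T-⊥' : ¬ T (eval ⊥' g ρ η)
  ¬T-⊥' p with anySubset-witness (size g) p
  ... | S , q with ⇔.to (T-anyFin (size g)) q
  ... | u , r = noContradiction (S u) r
    where
    noContradiction : ∀ b → ¬ T (b ∧ not b)
    noContradiction true  ()
    noContradiction false ()

  eval-⊥' : eval ⊥' g ρ η ≡ false
  eval-⊥' = ⇔.to T-not-≡ (⇔.from T-not ¬T-⊥')

  eval-⋁' : ∀ n (F : Fin n → Formula σ γ i j) → eval (⋁' n F) g ρ η ≡ anyFin n (λ k → eval (F k) g ρ η)
  eval-⋁' zero    F = eval-⊥'
  eval-⋁' (suc n) F = cong (eval (F fz) g ρ η ∨_) (eval-⋁' n (F ∘ fs))

  T-∀ₙ : ∀ (φ : Formula σ γ (suc i) j) → T (eval (∀ₙ φ) g ρ η) ⇔ ∀ u → T (eval φ g (u ∷ᶠ ρ) η)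
  T-∀ₙ φ = T-allFin (size g)

  T-∃ₙ : ∀ (φ : Formula σ γ (suc i) j) → T (eval (∃ₙ φ) g ρ η) ⇔ ∃ λ u → T (eval φ g (u ∷ᶠ ρ) η)
  T-∃ₙ φ = T-anyFin (size g)

  T-⋁' : ∀ n (F : Fin n → Formula σ γ i j) → T (eval (⋁' n F) g ρ η) ⇔ ∃ λ k → T (eval (F k) g ρ η)
  T-⋁' n F rewrite eval-⋁' n F = T-anyFin n

  T-⋀' : ∀ n (F : Fin n → Formula σ γ i j) → T (eval (⋀' n F) g ρ η) ⇔ ∀ k → T (eval (F k) g ρ η)
  T-⋀' n F rewrite eval-⋁' n (¬' ∘ F) = T-allFin n


-- Subsets and counting

Sub : (A : Set) → (A → Bool) → Set
Sub A P = Σ A (T ∘ P)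

Sub-≡ : ∀ {A : Set} {P : A → Bool} {x y} {p : T (P x)} {q : T (P y)} → x ≡ y →
        _≡_ {A = Sub A P} (x , p) (y , q)
Sub-≡ refl = cong (_ ,_) (T-irrelevant _ _)

module _ {A : Set} {P : A → Bool} where

  Sub-cong : ∀ {Q : A → Bool} → P ≗ Q → Sub A P ↔ Sub A Q
  Sub-cong e = mk↔ₛ′ (λ (x , p) → x , subst T (e x) p) (λ (x , q) → x , subst T (sym (e x)) q)
                     (λ _ → Sub-≡ refl) (λ _ → Sub-≡ refl)

  Sub-nested : ∀ {Q : A → Bool} → (∀ x → T (Q x) → T (P x)) → Sub A Q ↔ Sub (Sub A P) (Q ∘ proj₁)
  Sub-nested Q⊆P = mk↔ₛ′ (λ (x , q) → (x , Q⊆P x q) , q) (λ ((x , _) , q) → x , q)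
                         (λ _ → Sub-≡ (Sub-≡ refl)) (λ _ → refl)

Sub-↔ : ∀ {A B : Set} (f : A ↔ B) {Q : B → Bool} → Sub A (Q ∘ ↔.to f) ↔ Sub B Q
Sub-↔ f {Q} = mk↔ₛ′ (λ (x , p) → ↔.to f x , p)
                    (λ (y , q) → ↔.from f y , subst (T ∘ Q) (sym (↔.strictlyInverseˡ f y)) q)
                    (λ (y , _) → Sub-≡ (↔.strictlyInverseˡ f y))
                    (λ (x , _) → Sub-≡ (↔.strictlyInverseʳ f x))

module _ {A B X : Set} {Q : (A ⊎ B) × X → Bool} where

  Sub-⊎× : Sub ((A ⊎ B) × X) Q ↔ (Sub (A × X) (Q ∘ map₁ inj₁) ⊎ Sub (B × X) (Q ∘ map₁ inj₂))
  Sub-⊎× = mk↔ₛ′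
    (λ { ((inj₁ a , x) , q) → inj₁ ((a , x) , q) ; ((inj₂ b , x) , q) → inj₂ ((b , x) , q) })
    (λ { (inj₁ ((a , x) , q)) → (inj₁ a , x) , q ; (inj₂ ((b , x) , q)) → (inj₂ b , x) , q })
    (λ { (inj₁ _) → refl ; (inj₂ _) → refl })
    (λ { ((inj₁ _ , _) , _) → refl ; ((inj₂ _ , _) , _) → refl })

  Sub-⊎×-side : ∀ {Z : Set} (z z′ : Z) o →
                [ const z , const z′ ]′ (↔.to Sub-⊎× o) ≡ [ const z , const z′ ]′ (proj₁ (proj₁ o))
  Sub-⊎×-side z z′ ((inj₁ _ , _) , _) = refl
  Sub-⊎×-side z z′ ((inj₂ _ , _) , _) = refl

+×↔⊎× : ∀ {m n} {X : Set} → ((Fin m ⊎ Fin n) × X) ↔ (Fin (m + n) × X)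
+×↔⊎× {m} {n} = mk↔ₛ′ (map₁ (join m n)) (map₁ (splitAt m))
  (λ (c , x) → cong (_, x) (join-splitAt m n c)) (λ (s , x) → cong (_, x) (splitAt-join m n s))

extendSub : ∀ {A : Set} (P : A → Bool) → (Sub A P → Bool) → A → Bool
extendSub P Q x = whenT (P x) λ p → Q (x , p)

count-zero : ∀ n {P : Fin n → Bool} → (∀ s → P s ≡ false) → count n P ≡ 0
count-zero zero    _      = refl
count-zero (suc n) P≡false rewrite P≡false fz = count-zero n (P≡false ∘ fs)

count-single : ∀ {n} (P : Fin n → Bool) k → (∀ s → s ≢ k → P s ≡ false) → count n P ≡ b2n (P k)
count-single {suc n} P fz     P≡false =
  trans (cong (b2n (P fz) +_) (count-zero n λ s → P≡false (fs s) λ ())) (+-identityʳ _)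
count-single {suc n} P (fs k) P≡false rewrite P≡false fz (λ ()) =
  count-single (P ∘ fs) k λ s s≢k → P≡false (fs s) (s≢k ∘ fs-injective)

count↔Sub : ∀ n (P : Fin n → Bool) → Fin (count n P) ↔ Sub (Fin n) P
count↔Sub zero    P = mk↔ₛ′ (λ ()) (λ ()) (λ ()) (λ ())
count↔Sub (suc n) P =
  ↔-trans +↔⊎ (↔-trans (b2n↔T (P fz) ⊎-cong count↔Sub n (P ∘ fs)) (↔-sym Sub-suc))
  where
  b2n↔T : ∀ b → Fin (b2n b) ↔ T b
  b2n↔T true  = 1↔⊤
  b2n↔T false = 0↔⊥
  Sub-suc : Sub (Fin (suc n)) P ↔ (T (P fz) ⊎ Sub (Fin n) (P ∘ fs))
  Sub-suc = mk↔ₛ′ (λ { (fz , p) → inj₁ p ; (fs k , p) → inj₂ (k , p) })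
                  (λ { (inj₁ p) → fz , p ; (inj₂ (k , p)) → fs k , p })
                  (λ { (inj₁ _) → refl ; (inj₂ _) → refl })
                  (λ { (fz , _) → refl ; (fs _ , _) → refl })

prefix↔Fin : ∀ {N m} {P : Fin N → Bool} → m ≤ N → (∀ k → T (P k) ⇔ toℕ k < m) → Sub (Fin N) P ↔ Fin m
prefix↔Fin {m = m} m≤N P⇔<m = mk↔ₛ′
  (λ (k , p) → fromℕ< (⇔.to (P⇔<m k) p))
  (λ j → inject≤ j m≤N , ⇔.from (P⇔<m _) (subst (_< m) (sym (toℕ-inject≤ j m≤N)) (toℕ<n j)))
  (λ j → toℕ-injective (trans (toℕ-fromℕ< _) (toℕ-inject≤ j m≤N)))
  (λ (k , _) → Sub-≡ (toℕ-injective (trans (toℕ-inject≤ _ m≤N) (toℕ-fromℕ< _))))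


-- Lists and discrete graphs

cast↔ : ∀ {m n} → m ≡ n → Fin m ↔ Fin n
cast↔ e = mk↔ₛ′ (cast e) (cast (sym e)) (cast-involutive e (sym e)) (cast-involutive (sym e) e)

module _ {X : Set} where

  lookup-++-↑ˡ : ∀ (L L′ : List X) k .(e : length L + length L′ ≡ length (L ++ L′)) →
                 lookup (L ++ L′) (cast e (k ↑ˡ length L′)) ≡ lookup L k
  lookup-++-↑ˡ (x ∷ L) L′ fz     e = refl
  lookup-++-↑ˡ (x ∷ L) L′ (fs k) e = lookup-++-↑ˡ L L′ k _

  lookup-++-↑ʳ : ∀ (L L′ : List X) k .(e : length L + length L′ ≡ length (L ++ L′)) →
                 lookup (L ++ L′) (cast e (length L ↑ʳ k)) ≡ lookup L′ k
  lookup-++-↑ʳ []      L′ k e = cong (lookup L′) (cast-is-id e k)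
  lookup-++-↑ʳ (x ∷ L) L′ k e = lookup-++-↑ʳ L L′ k _

module _ {A : Set} where

  /≡just⇔ : ∀ (w : List A) m {a} → w / m ≡ just a ⇔ ∃ λ i → m ≡ suc (toℕ i) × lookup w i ≡ a
  /≡just⇔ []                _ = mk⇔ (λ ()) (λ ())
  /≡just⇔ (x ∷ w)     zero    = mk⇔ (λ ()) (λ { (_ , () , _) })
  /≡just⇔ (x ∷ w) (suc zero)  = mk⇔ (λ x≡a → fz , refl , just-injective x≡a)
                                    (λ { (fz , _ , refl) → refl ; (fs _ , () , _) })
  /≡just⇔ (x ∷ w) (suc (suc m)) = mk⇔
    (λ p → let (i , e , l) = ⇔.to (/≡just⇔ w (suc m)) p in fs i , cong suc e , l)
    (λ { (fs i , e , l) → ⇔.from (/≡just⇔ w (suc m)) (i , suc-injective e , l) })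

/≡just⇒bounds : ∀ {A : Set} (w : List A) {m a} → w / m ≡ just a → 1 ≤ m × m ≤ length w
/≡just⇒bounds w {m} w/m≡a with ⇔.to (/≡just⇔ w m) w/m≡a
... | i , refl , _ = s≤s z≤n , toℕ<n i

record Enumeration {A : Set} (ℓ : A → Fin d) (L : List (Fin d)) : Set where
  constructor mkEnumeration
  field
    bij      : A ↔ Fin (length L)
    labelled : ∀ x → lookup L (↔.to bij x) ≡ ℓ x

module _ {A : Set} {L : List (Fin d)} where

  Enumeration-↔ : ∀ {B : Set} {ℓ : B → Fin d} (f : A ↔ B) → Enumeration ℓ L → Enumeration (ℓ ∘ ↔.to f) L
  Enumeration-↔ f (mkEnumeration e labelled) = mkEnumeration (↔-trans f e) (labelled ∘ ↔.to f)

  Enumeration-cong : ∀ {ℓ ℓ′ : A → Fin d} → ℓ ≗ ℓ′ → Enumeration ℓ L → Enumeration ℓ′ L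
  Enumeration-cong ℓ≗ℓ′ (mkEnumeration e labelled) = mkEnumeration e λ x → trans (labelled x) (ℓ≗ℓ′ x)

Enumeration-replicate : ∀ {A : Set} {m} (a : Fin d) → A ↔ Fin m → Enumeration {A = A} (const a) (replicate m a)
Enumeration-replicate {m = m} a f =
  mkEnumeration (↔-trans f (cast↔ (sym (length-replicate m)))) λ x → lookup-replicate m a (↔.to f x)

Enumeration-++ : ∀ {A B : Set} {ℓ : A → Fin d} {ℓ′ : B → Fin d} {L L′} →
                 Enumeration ℓ L → Enumeration ℓ′ L′ → Enumeration [ ℓ , ℓ′ ]′ (L ++ L′)
Enumeration-++ {L = L} {L′} (mkEnumeration e labelled) (mkEnumeration e′ labelled′) =
  mkEnumeration (↔-trans (e ⊎-cong e′) (↔-trans (↔-sym +↔⊎) (cast↔ (sym (length-++ L)))))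
    λ { (inj₁ x) → trans (lookup-++-↑ˡ L L′ (↔.to e x) _) (labelled x)
      ; (inj₂ y) → trans (lookup-++-↑ʳ L L′ (↔.to e′ y) _) (labelled′ y) }

≅dgr⇔ : ∀ {h : Graph d γ} {L} → h ≅ dgr L ⇔ (IsDGraph h × Enumeration (lab h) L)
≅dgr⇔ = mk⇔
  (λ h≅ → (λ u t v → sym (_≅_.edge-pres h≅ u t v)) , mkEnumeration (_≅_.bij h≅) (_≅_.lab-pres h≅))
  (λ (discrete , mkEnumeration f labelled) → record
    { bij = f ; lab-pres = labelled ; edge-pres = λ u t v → sym (discrete u t v) })


-- Cuts of strings

T-letterAt : ∀ (w : List (Fin d)) k {t} → T (letterAt w k t) ⇔ ∃ λ i → toℕ i ≡ k × lookup w i ≡ t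
T-letterAt []            _ = mk⇔ (λ ()) (λ ())
T-letterAt (x ∷ w) zero    = mk⇔ (λ p → fz , refl , toWitness p)
                                 (λ { (fz , _ , x≡t) → fromWitness x≡t })
T-letterAt (x ∷ w) (suc k) = mk⇔
  (λ p → let (i , e , l) = ⇔.to (T-letterAt w k) p in fs i , cong suc e , l)
  (λ { (fs i , e , l) → ⇔.from (T-letterAt w k) (i , suc-injective e , l) })

T-strEdge : ∀ (w : List (Fin d)) u t v →
            T (edge (strGraph w) u t v) ⇔ ∃ λ i → u ≡ inject₁ i × v ≡ fs i × lookup w i ≡ t
T-strEdge w u t v = mk⇔ to from
  where
  to : T (edge (strGraph w) u t v) → ∃ λ i → u ≡ inject₁ i × v ≡ fs i × lookup w i ≡ t
  to p = let (v≡u+1 , letter) = ⇔.to T-∧ p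
             (i , i≡u , l) = ⇔.to (T-letterAt w (toℕ u)) letter
         in i , toℕ-injective (trans (sym i≡u) (sym (toℕ-inject₁ i))) ,
            toℕ-injective (trans (≡ᵇ⇒≡ _ _ v≡u+1) (cong suc (sym i≡u))) , l
  from : (∃ λ i → u ≡ inject₁ i × v ≡ fs i × lookup w i ≡ t) → T (edge (strGraph w) u t v)
  from (i , refl , refl , l) = ⇔.from T-∧
    (≡⇒≡ᵇ _ _ (cong suc (sym (toℕ-inject₁ i))) , ⇔.from (T-letterAt w _) (i , sym (toℕ-inject₁ i) , l))

Edges : Set → ℕ → Set
Edges V γ = V → Fin γ → V → Bool

record IsCut {V : Set} (E : Edges V γ) (a : Fin γ) (S : V → Bool) : Set where
  field
    closed : ∀ u t v → T (E u t v) → T (S v) → T (S u)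
    exit   : ∃₂ λ u v → T (S u) × ¬ T (S v) × T (E u a v)

IsCut-cong : ∀ {V : Set} {E : Edges V γ} {a} {S S′ : V → Bool} → S ≗ S′ → IsCut E a S → IsCut E a S′
IsCut-cong S≗S′ cut = record
  { closed = λ u t v Euv S′v → subst T (S≗S′ u) (closed u t v Euv (subst T (sym (S≗S′ v)) S′v))
  ; exit   = let (u , v , Su , ¬Sv , Eu) = exit
             in u , v , subst T (S≗S′ u) Su , ¬Sv ∘ subst T (sym (S≗S′ v)) , Eu }
  where open IsCut cut

downward-closed : ∀ {n} {S : Fin (suc n) → Bool} → (∀ i → T (S (fs i)) → T (S (inject₁ i))) →
                  ∀ j → T (S j) → ∀ k → toℕ k ≤ toℕ j → T (S k)
downward-closed {n} {S} step = <-weakInduction Below base next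
  where
  Below : Fin (suc n) → Set
  Below j = T (S j) → ∀ k → toℕ k ≤ toℕ j → T (S k)
  base : Below fz
  base S0 fz z≤n = S0
  next : ∀ i → Below (inject₁ i) → Below (fs i)
  next i below Ssi k k≤i+1 with m≤n⇒m<n∨m≡n k≤i+1
  ... | inj₂ k≡i+1     = subst (T ∘ S) (toℕ-injective (sym k≡i+1)) Ssi
  ... | inj₁ (s≤s k≤i) = below (step i Ssi) k (subst (toℕ k ≤_) (sym (toℕ-inject₁ i)) k≤i)

module _ (w : List (Fin d)) {a : Fin d} where

  string-cut⇒prefix : ∀ {S} → IsCut (edge (strGraph w)) a S →
                      ∃ λ m → w / m ≡ just a × (∀ k → T (S k) ⇔ toℕ k < m)
  string-cut⇒prefix {S} cut with IsCut.exit cut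
  ... | u , v , Su , ¬Sv , Euav with ⇔.to (T-strEdge w u a v) Euav
  ... | i , refl , refl , lookup≡a =
    suc (toℕ i) , ⇔.from (/≡just⇔ w _) (i , refl , lookup≡a) , λ k → mk⇔ (≤i k) (≤i⇒S k ∘ ≤-pred)
    where
    step : ∀ j → T (S (fs j)) → T (S (inject₁ j))
    step j = IsCut.closed cut _ _ _ (⇔.from (T-strEdge w _ _ _) (j , refl , refl , refl))
    ≤i⇒S : ∀ k → toℕ k ≤ toℕ i → T (S k)
    ≤i⇒S k k≤i = downward-closed step (inject₁ i) Su k (subst (toℕ k ≤_) (sym (toℕ-inject₁ i)) k≤i)
    ≤i : ∀ k → T (S k) → toℕ k < suc (toℕ i)
    ≤i k Sk with toℕ k ≤? toℕ i
    ... | yes k≤i = s≤s k≤i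
    ... | no  k≰i = contradiction (downward-closed step k Sk (fs i) (≰⇒> k≰i)) ¬Sv

  prefix⇒string-cut : ∀ {m} → w / m ≡ just a → IsCut (edge (strGraph w)) a (λ k → toℕ k <ᵇ m)
  prefix⇒string-cut {m} w/m≡a with ⇔.to (/≡just⇔ w m) w/m≡a
  ... | i , refl , lookup≡a = record
    { closed = λ u t v Euv v<m →
        <⇒<ᵇ (<-trans (edge-increases u t v Euv) (<ᵇ⇒< (toℕ v) (suc (toℕ i)) v<m))
    ; exit   = inject₁ i , fs i , <⇒<ᵇ (s≤s (≤-reflexive (toℕ-inject₁ i))) ,
               (λ i+1<i+1 → <-irrefl refl (<ᵇ⇒< (suc (toℕ i)) _ i+1<i+1)) ,
               ⇔.from (T-strEdge w _ _ _) (i , refl , refl , lookup≡a) }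
    where
    edge-increases : ∀ u t v → T (edge (strGraph w) u t v) → toℕ u < toℕ v
    edge-increases u t v Euv with ⇔.to (T-strEdge w u t v) Euv
    ... | j , refl , refl , _ = s≤s (≤-reflexive (toℕ-inject₁ j))

restrict : ∀ {A : Set} → Edges A γ → (P : A → Bool) → Edges (Sub A P) γ
restrict E P (x , _) t (y , _) = E x t y

module _ {A : Set} (P : A → Bool) (E : Edges A γ) where

  ClosedWithin : (A → Bool) → Set
  ClosedWithin S = ∀ x t y → T (P x) → T (E x t y) → T (S y) → T (S x)

  ExitsWithin : Fin γ → (A → Bool) → Set
  ExitsWithin a S = ∃₂ λ x y → T (S x) × T (P y) × ¬ T (S y) × T (E x a y)

module _ {A : Set} {P : A → Bool} {E : Edges A γ} {a : Fin γ} {S : A → Bool} where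

  IsCut-restrict⇔ : (∀ x → T (S x) → T (P x)) →
                    IsCut (restrict E P) a (S ∘ proj₁) ⇔ (ClosedWithin P E S × ExitsWithin P E a S)
  IsCut-restrict⇔ S⊆P = mk⇔ to from
    where
    to : IsCut (restrict E P) a (S ∘ proj₁) → ClosedWithin P E S × ExitsWithin P E a S
    to cut with IsCut.exit cut
    ... | (x , _) , (y , Py) , Sx , ¬Sy , Exy =
      (λ x t y Px Exy Sy → IsCut.closed cut (x , Px) t (y , S⊆P y Sy) Exy Sy) , (x , y , Sx , Py , ¬Sy , Exy)
    from : ClosedWithin P E S × ExitsWithin P E a S → IsCut (restrict E P) a (S ∘ proj₁)
    from (closed , (x , y , Sx , Py , ¬Sy , Exy)) = record
      { closed = λ (x , Px) t (y , _) → closed x t y Px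
      ; exit   = (x , S⊆P x Sx) , (y , Py) , Sx , ¬Sy , Exy }

record EdgeIso {V W : Set} (E : Edges V γ) (F : Edges W γ) : Set where
  field
    bij       : V ↔ W
    preserves : ∀ u t v → F (↔.to bij u) t (↔.to bij v) ≡ E u t v

module _ {U V : Set} {E : Edges U γ} {F : Edges V γ} where

  EdgeIso-sym : EdgeIso E F → EdgeIso F E
  EdgeIso-sym φ = record
    { bij       = ↔-sym bij
    ; preserves = λ u t v →
        trans (sym (preserves _ t _))
              (cong₂ (λ x y → F x t y) (↔.strictlyInverseˡ bij u) (↔.strictlyInverseˡ bij v)) }
    where open EdgeIso φ

  EdgeIso-trans : ∀ {W : Set} {G : Edges W γ} → EdgeIso E F → EdgeIso F G → EdgeIso E G
  EdgeIso-trans φ ψ = record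
    { bij       = ↔-trans (EdgeIso.bij φ) (EdgeIso.bij ψ)
    ; preserves = λ u t v → trans (EdgeIso.preserves ψ _ t _) (EdgeIso.preserves φ u t v) }

IsCut-pull : ∀ {V W : Set} {E : Edges V γ} {F : Edges W γ} {a} {S : W → Bool} →
             (φ : EdgeIso E F) → IsCut F a S → IsCut E a (S ∘ ↔.to (EdgeIso.bij φ))
IsCut-pull {F = F} {a} {S} φ cut = record
  { closed = λ u t v Euv → closed _ t _ (subst T (sym (preserves u t v)) Euv)
  ; exit   = let (x , y , Sx , ¬Sy , Fxy) = exit
             in ↔.from bij x , ↔.from bij y ,
                subst (T ∘ S) (sym (↔.strictlyInverseˡ bij x)) Sx ,
                ¬Sy ∘ subst (T ∘ S) (↔.strictlyInverseˡ bij y) ,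
                subst T (trans (cong₂ (λ x y → F x a y) (sym (↔.strictlyInverseˡ bij x))
                                                        (sym (↔.strictlyInverseˡ bij y)))
                               (preserves _ a _)) Fxy }
  where
  open IsCut cut
  open EdgeIso φ

≅⇒EdgeIso : ∀ {g h : Graph σ γ} → g ≅ h → EdgeIso (edge g) (edge h)
≅⇒EdgeIso g≅h = record { bij = _≅_.bij g≅h ; preserves = _≅_.edge-pres g≅h }


-- Outputs of graph-to-string transducers

module _ {σ₂ γ₂} (M : Transducer σ₁ γ₁ σ₂ γ₂) (g : Graph σ₁ γ₁)
         (Y : Fin (params M) → Fin (size g) → Bool) where

  copyEdges : Edges (Fin (copies M) × Fin (size g)) γ₂
  copyEdges (c , u) t (c′ , u′) = eval (edgeF M c c′ t) g (u ∷ᶠ u′ ∷ᶠ []ᶠ) Y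

  outEdges : Edges (OutNode M g Y) γ₂
  outEdges = restrict copyEdges (isOutNode M g Y)

  IsOutput⇒EdgeIso : ∀ {h} → IsOutput M g Y h → EdgeIso (edge h) outEdges
  IsOutput⇒EdgeIso out = record
    { bij = IsOutput.bij out ; preserves = λ u t v → sym (IsOutput.edge-pres out u t v) }

OutputCut : ∀ {σ₂ γ₂} (M : Transducer σ₁ γ₁ σ₂ γ₂) (g : Graph σ₁ γ₁)
            (Y : Fin (params M) → Fin (size g) → Bool) →
            Fin γ₂ → (Fin (copies M) × Fin (size g) → Bool) → Set
OutputCut M g Y a S = (∀ x → T (S x) → T (isOutNode M g Y x)) × IsCut (outEdges M g Y) a (S ∘ proj₁)

module _ {γ₂} (M : Transducer σ₁ γ₁ 1 γ₂) (g : Graph σ₁ γ₁)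
         (Y : Fin (params M) → Fin (size g) → Bool) where

  isOutNode-unary : ∀ c u → isOutNode M g Y (c , u) ≡ nodeHolds M g Y c u fz
  isOutNode-unary c u with nodeHolds M g Y c u fz
  ... | true  = refl
  ... | false = refl

  outputSize : ℕ
  outputSize = count (copies M * size g) (isOutNode M g Y ∘ ↔.to *↔×)

  outputNodes : Fin outputSize ↔ OutNode M g Y
  outputNodes = ↔-trans (count↔Sub _ _) (Sub-↔ *↔×)

  outputGraph : Graph 1 γ₂
  outputGraph = record
    { size = outputSize
    ; lab  = const fz
    ; edge = λ v t w → outEdges M g Y (↔.to outputNodes v) t (↔.to outputNodes w) }

  outputGraph-isOutput : IsOutput M g Y outputGraph
  outputGraph-isOutput = record
    { bij       = outputNodes
    ; lab-pres  = λ v → let ((c , u) , out) = ↔.to outputNodes v in subst T (isOutNode-unary c u) out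
    ; edge-pres = λ _ _ _ → refl }

module _ (M : Transducer σ₁ γ₁ 1 d) (g : Graph σ₁ γ₁) (Y : Fin (params M) → Fin (size g) → Bool)
         (w : List (Fin d)) (ψ : EdgeIso (edge (strGraph w)) (outEdges M g Y)) {a : Fin d} where

  open EdgeIso ψ using (bij)

  private
    Copies = Fin (copies M) × Fin (size g)

  prefix-count : ∀ {m} {S : Copies → Bool} → (∀ x → T (S x) → T (isOutNode M g Y x)) → w / m ≡ just a →
                 (∀ k → T (S (proj₁ (↔.to bij k))) ⇔ toℕ k < m) → Sub Copies S ↔ Fin m
  prefix-count S⊆out w/m≡a S⇔<m =
    ↔-trans (Sub-nested S⊆out) (↔-trans (↔-sym (Sub-↔ bij)) (prefix↔Fin m≤1+|w| S⇔<m))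
    where m≤1+|w| = ≤-trans (proj₂ (/≡just⇒bounds w w/m≡a)) (n≤1+n _)

  output-cut⇒prefix : ∀ {S : Copies → Bool} → OutputCut M g Y a S →
                      ∃ λ m → w / m ≡ just a × (Sub Copies S ↔ Fin m)
  output-cut⇒prefix (S⊆out , cut) =
    let (m , w/m≡a , S⇔<m) = string-cut⇒prefix w (IsCut-pull ψ cut)
    in m , w/m≡a , prefix-count S⊆out w/m≡a S⇔<m

  output-prefix⇒cut : ∀ {m} → w / m ≡ just a →
                      ∃ λ (S : Copies → Bool) → OutputCut M g Y a S × (Sub Copies S ↔ Fin m)
  output-prefix⇒cut {m} w/m≡a = S , (S⊆out , cut) , prefix-count S⊆out w/m≡a S⇔<m
    where
    before-m : OutNode M g Y → Bool
    before-m o = toℕ (↔.from bij o) <ᵇ m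
    S : Copies → Bool
    S = extendSub (isOutNode M g Y) before-m
    S⊆out : ∀ x → T (S x) → T (isOutNode M g Y x)
    S⊆out x = whenT-T (isOutNode M g Y x)
    S-before-m : ∀ o → before-m o ≡ S (proj₁ o)
    S-before-m (x , out) = sym (whenT-≡ (isOutNode M g Y x) out)
    cut : IsCut (outEdges M g Y) a (S ∘ proj₁)
    cut = IsCut-cong S-before-m (IsCut-pull (EdgeIso-sym ψ) (prefix⇒string-cut w w/m≡a))
    S⇔<m : ∀ k → T (S (proj₁ (↔.to bij k))) ⇔ toℕ k < m
    S⇔<m k rewrite sym (S-before-m (↔.to bij k)) | ↔.strictlyInverseʳ bij k = mk⇔ (<ᵇ⇒< _ _) (<⇒<ᵇ)

outputString : ∀ {M : Transducer σ₁ γ₁ 1 d} {g Y h w} → IsOutput M g Y h → h ≅ strGraph w →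
               EdgeIso (edge (strGraph w)) (outEdges M g Y)
outputString out h≅w = EdgeIso-trans (EdgeIso-sym (≅⇒EdgeIso h≅w)) (IsOutput⇒EdgeIso _ _ _ out)

module _ (M : Transducer σ₁ γ₁ 1 d) {g : Graph σ₁ γ₁} {a : Fin d} where

  cut⇒letter : GraphToString M → ∀ {Y S} → T (eval (dom M) g (λ ()) Y) → OutputCut M g Y a S →
               ∃ λ m → m ≥ 1 × (Sub _ S ↔ Fin m) × ∃ λ h → h ∈⟦ M ⟧ g × StrLetter h m a
  cut⇒letter toString {Y} domY cut =
    let out = outputGraph-isOutput M g Y
        (w , h≅w) = toString g (outputGraph M g Y) (Y , domY , out)
        (m , w/m≡a , count) = output-cut⇒prefix M g Y w (outputString {w = w} out h≅w) cut
    in m , proj₁ (/≡just⇒bounds w w/m≡a) , count , outputGraph M g Y , (Y , domY , out) , w , h≅w , w/m≡a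

  letter⇒cut : ∀ {h m} (h∈ : h ∈⟦ M ⟧ g) → StrLetter h m a →
               ∃ λ S → OutputCut M g (proj₁ h∈) a S × (Sub _ S ↔ Fin m)
  letter⇒cut (Y , _ , out) (w , h≅w , w/m≡a) =
    output-prefix⇒cut M g Y w (outputString {w = w} out h≅w) w/m≡a


module CutFormula {k} (M : Transducer σ₁ γ₁ 1 d) (ιY : Fin (params M) → Fin k) (ιS : Fin (copies M) → Fin k)
  where

  private
    C = copies M

  isNode : Fin C → Fin i → Formula σ₁ γ₁ i k
  isNode c x = ren (x ∷ᶠ []ᶠ) ιY (node M c 0F)

  hasEdge : Fin C → Fin C → Fin d → Fin i → Fin i → Formula σ₁ γ₁ i k
  hasEdge c c′ t x y = ren (x ∷ᶠ y ∷ᶠ []ᶠ) ιY (edgeF M c c′ t)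

  inCut : Fin C → Fin i → Formula σ₁ γ₁ i k
  inCut c x = memF x (ιS c)

  withinBody : Fin C → Formula σ₁ γ₁ 1 k
  withinBody c = inCut c 0F ⇒' isNode c 0F

  closedBody : Fin C → Fin C → Fin d → Formula σ₁ γ₁ 2 k
  closedBody c c′ t = (isNode c 1F ∧' (hasEdge c c′ t 1F 0F ∧' inCut c′ 0F)) ⇒' inCut c 1F

  exitBody : Fin d → Fin C → Fin C → Formula σ₁ γ₁ 2 k
  exitBody a c c′ = inCut c 1F ∧' (isNode c′ 0F ∧' (¬' (inCut c′ 0F) ∧' hasEdge c c′ a 1F 0F))

  allClosed : Formula σ₁ γ₁ 2 k
  allClosed = ⋀' C λ c → ⋀' C λ c′ → ⋀' d (closedBody c c′)

  someExit : Fin d → Formula σ₁ γ₁ 2 k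
  someExit a = ⋁' C λ c → ⋁' C (exitBody a c)

  cutFormula : Fin d → Formula σ₁ γ₁ 0 k
  cutFormula a = ∀ₙ (⋀' C withinBody) ∧' (∀ₙ (∀ₙ allClosed) ∧' ∃ₙ (∃ₙ (someExit a)))

  module _ (g : Graph σ₁ γ₁) {η : Fin k → Fin (size g) → Bool}
           {Y : Fin (params M) → Fin (size g) → Bool} {S : Fin C × Fin (size g) → Bool}
           (ηY : ∀ X u → η (ιY X) u ≡ Y X u) (ηS : ∀ c u → η (ιS c) u ≡ S (c , u))
           (ρ₀ : Fin 0 → Fin (size g)) where

    private
      P = isOutNode M g Y
      E = copyEdges M g Y

    module _ (ρ : Fin i → Fin (size g)) where

      eval-isNode : ∀ c x → eval (isNode c x) g ρ η ≡ P (c , ρ x)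
      eval-isNode c x = trans (eval-ren (node M c 0F) g (x ∷ᶠ []ᶠ) ιY (λ { 0F → refl }) ηY)
                              (sym (isOutNode-unary M g Y c (ρ x)))

      eval-hasEdge : ∀ c c′ t x y → eval (hasEdge c c′ t x y) g ρ η ≡ E (c , ρ x) t (c′ , ρ y)
      eval-hasEdge c c′ t x y =
        eval-ren (edgeF M c c′ t) g (x ∷ᶠ y ∷ᶠ []ᶠ) ιY (λ { 0F → refl ; 1F → refl }) ηY

      eval-inCut : ∀ c x → eval (inCut c x) g ρ η ≡ S (c , ρ x)
      eval-inCut c x = ηS c (ρ x)

    eval-withinBody : ∀ c u → eval (withinBody c) g (u ∷ᶠ ρ₀) η ≡ (not (S (c , u)) ∨ P (c , u))
    eval-withinBody c u = cong₂ (λ s p → not s ∨ p) (eval-inCut ρ c 0F) (eval-isNode ρ c 0F)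
      where ρ = u ∷ᶠ ρ₀

    eval-closedBody : ∀ c c′ t u u′ → let x = (c , u) ; y = (c′ , u′) in
      eval (closedBody c c′ t) g (u′ ∷ᶠ u ∷ᶠ ρ₀) η ≡ (not (P x ∧ (E x t y ∧ S y)) ∨ S x)
    eval-closedBody c c′ t u u′ =
      cong₂ (λ p q → not p ∨ q)
            (cong₂ _∧_ (eval-isNode ρ c 1F) (cong₂ _∧_ (eval-hasEdge ρ c c′ t 1F 0F) (eval-inCut ρ c′ 0F)))
            (eval-inCut ρ c 1F)
      where ρ = u′ ∷ᶠ u ∷ᶠ ρ₀

    eval-exitBody : ∀ a c c′ u u′ → let x = (c , u) ; y = (c′ , u′) in
      eval (exitBody a c c′) g (u′ ∷ᶠ u ∷ᶠ ρ₀) η ≡ (S x ∧ (P y ∧ (not (S y) ∧ E x a y)))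
    eval-exitBody a c c′ u u′ =
      cong₂ _∧_ (eval-inCut ρ c 1F)
                (cong₂ _∧_ (eval-isNode ρ c′ 0F)
                           (cong₂ _∧_ (cong not (eval-inCut ρ c′ 0F)) (eval-hasEdge ρ c c′ a 1F 0F)))
      where ρ = u′ ∷ᶠ u ∷ᶠ ρ₀

    T-within : T (eval (∀ₙ (⋀' C withinBody)) g ρ₀ η) ⇔ (∀ x → T (S x) → T (P x))
    T-within = mk⇔
      (λ p (c , u) → ⇔.to T-⇒ (subst T (eval-withinBody c u)
         (⇔.to (T-⋀' g C withinBody) (⇔.to (T-∀ₙ g (⋀' C withinBody)) p u) c)))
      (λ S⊆P → ⇔.from (T-∀ₙ g (⋀' C withinBody)) λ u → ⇔.from (T-⋀' g C withinBody) λ c →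
         subst T (sym (eval-withinBody c u)) (⇔.from T-⇒ (S⊆P (c , u))))

    T-allClosed : ∀ u u′ → T (eval allClosed g (u′ ∷ᶠ u ∷ᶠ ρ₀) η) ⇔
                  (∀ c c′ t → T (P (c , u)) → T (E (c , u) t (c′ , u′)) → T (S (c′ , u′)) → T (S (c , u)))
    T-allClosed u u′ = mk⇔
      (λ p c c′ t Px Exy Sy → ⇔.to T-⇒ (subst T (eval-closedBody c c′ t u u′) (atBody p c c′ t))
         (⇔.from T-∧ (Px , ⇔.from T-∧ (Exy , Sy))))
      (λ closed → ⇔.from (T-⋀' g C _) λ c → ⇔.from (T-⋀' g C _) λ c′ →
         ⇔.from (T-⋀' g d (closedBody c c′)) λ t →
         subst T (sym (eval-closedBody c c′ t u u′)) (⇔.from T-⇒ λ q →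
           let (Px , r) = ⇔.to T-∧ q ; (Exy , Sy) = ⇔.to T-∧ r in closed c c′ t Px Exy Sy))
      where
      atBody : T (eval allClosed g (u′ ∷ᶠ u ∷ᶠ ρ₀) η) → ∀ c c′ t →
               T (eval (closedBody c c′ t) g (u′ ∷ᶠ u ∷ᶠ ρ₀) η)
      atBody p c c′ t =
        ⇔.to (T-⋀' g d (closedBody c c′)) (⇔.to (T-⋀' g C _) (⇔.to (T-⋀' g C _) p c) c′) t

    T-closed : T (eval (∀ₙ (∀ₙ allClosed)) g ρ₀ η) ⇔ ClosedWithin P E S
    T-closed = mk⇔
      (λ p (c , u) t (c′ , u′) →
         ⇔.to (T-allClosed u u′) (⇔.to (T-∀ₙ g allClosed) (⇔.to (T-∀ₙ g (∀ₙ allClosed)) p u) u′) c c′ t)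
      (λ closed → ⇔.from (T-∀ₙ g (∀ₙ allClosed)) λ u → ⇔.from (T-∀ₙ g allClosed) λ u′ →
         ⇔.from (T-allClosed u u′) λ c c′ t → closed (c , u) t (c′ , u′))

    T-someExit : ∀ a u u′ → T (eval (someExit a) g (u′ ∷ᶠ u ∷ᶠ ρ₀) η) ⇔
                 ∃₂ λ c c′ → T (S (c , u)) × T (P (c′ , u′)) × ¬ T (S (c′ , u′)) × T (E (c , u) a (c′ , u′))
    T-someExit a u u′ = mk⇔
      (λ p → let (c , q)      = ⇔.to (T-⋁' g C λ c → ⋁' C (exitBody a c)) p
                 (c′ , r)     = ⇔.to (T-⋁' g C (exitBody a c)) q
                 (Sx , r′)    = ⇔.to T-∧ (subst T (eval-exitBody a c c′ u u′) r)
                 (Py , r″)    = ⇔.to T-∧ r′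
                 (¬Sy , Exy)  = ⇔.to T-∧ r″
             in c , c′ , Sx , Py , ⇔.to T-not ¬Sy , Exy)
      (λ (c , c′ , Sx , Py , ¬Sy , Exy) →
         ⇔.from (T-⋁' g C λ c → ⋁' C (exitBody a c)) (c , ⇔.from (T-⋁' g C (exitBody a c)) (c′ ,
           subst T (sym (eval-exitBody a c c′ u u′))
             (⇔.from T-∧ (Sx , ⇔.from T-∧ (Py , ⇔.from T-∧ (⇔.from T-not ¬Sy , Exy)))))))

    T-exits : ∀ a → T (eval (∃ₙ (∃ₙ (someExit a))) g ρ₀ η) ⇔ ExitsWithin P E a S
    T-exits a = mk⇔
      (λ p → let (u , q)  = ⇔.to (T-∃ₙ g (∃ₙ (someExit a))) p
                 (u′ , r) = ⇔.to (T-∃ₙ g (someExit a)) q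
                 (c , c′ , exit) = ⇔.to (T-someExit a u u′) r
             in (c , u) , (c′ , u′) , exit)
      (λ ((c , u) , (c′ , u′) , exit) →
         ⇔.from (T-∃ₙ g (∃ₙ (someExit a))) (u , ⇔.from (T-∃ₙ g (someExit a)) (u′ ,
           ⇔.from (T-someExit a u u′) (c , c′ , exit))))

    T-cutFormula : ∀ a → T (eval (cutFormula a) g ρ₀ η) ⇔ OutputCut M g Y a S
    T-cutFormula a = mk⇔
      (λ p → let (within , q) = ⇔.to T-∧ p
                 (closed , exits) = ⇔.to T-∧ q
                 S⊆P = ⇔.to T-within within
             in S⊆P , ⇔.from (IsCut-restrict⇔ S⊆P) (⇔.to T-closed closed , ⇔.to (T-exits a) exits))
      (λ (S⊆P , cut) → let (closed , exits) = ⇔.to (IsCut-restrict⇔ S⊆P) cut in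
         ⇔.from T-∧ (⇔.from T-within S⊆P ,
                     ⇔.from T-∧ (⇔.from T-closed closed , ⇔.from (T-exits a) exits)))


-- The transducer Mᵃᵇ

module Mᵃᵇ (M₁ M₂ : Transducer σ₁ γ₁ 1 d) (a b : Fin d) (e : ℕ) where

  private
    p₁ = params M₁
    p₂ = params M₂
    c₁ = copies M₁
    c₂ = copies M₂

  Params : ℕ
  Params = p₁ + (p₂ + (c₁ + c₂))

  param₁ : Fin p₁ → Fin Params
  param₁ X = X ↑ˡ (p₂ + (c₁ + c₂))

  param₂ : Fin p₂ → Fin Params
  param₂ X = p₁ ↑ʳ (X ↑ˡ (c₁ + c₂))

  cutVar : Fin (c₁ + c₂) → Fin Params
  cutVar c = p₁ ↑ʳ (p₂ ↑ʳ c)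

  cutVar₁ : Fin c₁ → Fin Params
  cutVar₁ c = cutVar (c ↑ˡ c₂)

  cutVar₂ : Fin c₂ → Fin Params
  cutVar₂ c = cutVar (c₁ ↑ʳ c)

  label : Fin (c₁ + c₂) → Fin d
  label c = [ const a , const b ]′ (splitAt c₁ c)

  module Cut₁ = CutFormula M₁ param₁ cutVar₁
  module Cut₂ = CutFormula M₂ param₂ cutVar₂

  M : Transducer σ₁ γ₁ d e
  M = record
    { copies = c₁ + c₂
    ; params = Params
    ; dom    = (ren id param₁ (dom M₁) ∧' ren id param₂ (dom M₂)) ∧'
               (Cut₁.cutFormula a ∧' Cut₂.cutFormula b)
    ; node   = λ c s → if ⌊ s ≟ label c ⌋ then memF 0F (cutVar c) else ⊥'
    ; edgeF  = λ _ _ _ → ⊥' }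

  module _ (g : Graph σ₁ γ₁) (η : Fin Params → Fin (size g) → Bool) where

    private
      X = Fin (size g)

    nodeHolds-label : ∀ c u → nodeHolds M g η c u (label c) ≡ η (cutVar c) u
    nodeHolds-label c u with label c ≟ label c
    ... | yes _ = refl
    ... | no ℓ≢ℓ = contradiction refl ℓ≢ℓ

    nodeHolds-other : ∀ c u s → s ≢ label c → nodeHolds M g η c u s ≡ false
    nodeHolds-other c u s s≢ℓ with s ≟ label c
    ... | yes s≡ℓ = contradiction s≡ℓ s≢ℓ
    ... | no  _   = eval-⊥' g {ρ = u ∷ᶠ []ᶠ} {η}

    nodeHolds⇒label : ∀ c u s → T (nodeHolds M g η c u s) → s ≡ label c
    nodeHolds⇒label c u s holds with s ≟ label c
    ... | yes s≡ℓ = s≡ℓ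
    ... | no  _   = contradiction holds (¬T-⊥' g {ρ = u ∷ᶠ []ᶠ} {η})

    isOutNode-M : ∀ c u → isOutNode M g η (c , u) ≡ η (cutVar c) u
    isOutNode-M c u = begin
      count d (nodeHolds M g η c u) ≡ᵇ 1
        ≡⟨ cong (_≡ᵇ 1) (count-single _ (label c) (nodeHolds-other c u)) ⟩
      b2n (nodeHolds M g η c u (label c)) ≡ᵇ 1
        ≡⟨ cong (λ x → b2n x ≡ᵇ 1) (nodeHolds-label c u) ⟩
      b2n (η (cutVar c) u) ≡ᵇ 1
        ≡⟨ b2n≡ᵇ1 _ ⟩
      η (cutVar c) u
        ∎
      where open ≡-Reasoning

    cutSet₁ : Fin c₁ × X → Bool
    cutSet₁ (c , u) = η (cutVar₁ c) u

    cutSet₂ : Fin c₂ × X → Bool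
    cutSet₂ (c , u) = η (cutVar₂ c) u

    splitCopies : OutNode M g η ↔ Sub ((Fin c₁ ⊎ Fin c₂) × X) (uncurry (η ∘ cutVar) ∘ map₁ (join c₁ c₂))
    splitCopies = ↔-trans (Sub-cong (uncurry isOutNode-M)) (↔-sym (Sub-↔ +×↔⊎×))

    outNodes↔cuts : OutNode M g η ↔ (Sub (Fin c₁ × X) cutSet₁ ⊎ Sub (Fin c₂ × X) cutSet₂)
    outNodes↔cuts = ↔-trans splitCopies Sub-⊎×

    outNodes-Enumeration : ∀ {m n} → Sub (Fin c₁ × X) cutSet₁ ↔ Fin m → Sub (Fin c₂ × X) cutSet₂ ↔ Fin n →
                           Enumeration (label ∘ proj₁ ∘ proj₁) (replicate m a ++ replicate n b)
    outNodes-Enumeration f₁ f₂ =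
      Enumeration-cong (Sub-⊎×-side a b ∘ ↔.to splitCopies)
        (Enumeration-↔ outNodes↔cuts
          (Enumeration-++ (Enumeration-replicate a f₁) (Enumeration-replicate b f₂)))

    noEdges : ∀ c c′ t u u′ → eval (edgeF M c c′ t) g (u ∷ᶠ u′ ∷ᶠ []ᶠ) η ≡ false
    noEdges _ _ _ u u′ = eval-⊥' g {ρ = u ∷ᶠ u′ ∷ᶠ []ᶠ} {η}

    output-discrete : ∀ {h} → IsOutput M g η h → IsDGraph h
    output-discrete out v t w =
      let ((c , u) , _) = IsOutput.to out v ; ((c′ , u′) , _) = IsOutput.to out w
      in trans (IsOutput.edge-pres out v t w) (noEdges c c′ t u u′)

    output⇔dgr : ∀ {m n} {h : Graph d e} → Sub (Fin c₁ × X) cutSet₁ ↔ Fin m → Sub (Fin c₂ × X) cutSet₂ ↔ Fin n →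
                 IsOutput M g η h ⇔ h ≅ dgr (replicate m a ++ replicate n b)
    output⇔dgr {m} {n} {h} f₁ f₂ = mk⇔ to from
      where
      L = replicate m a ++ replicate n b
      enum = outNodes-Enumeration f₁ f₂
      open Enumeration enum using () renaming (bij to β; labelled to β-labelled)
      to : IsOutput M g η h → h ≅ dgr L
      to out = ⇔.from ≅dgr⇔
        (output-discrete out , Enumeration-cong labels (Enumeration-↔ (IsOutput.bij out) enum))
        where
        labels : ∀ v → label (proj₁ (proj₁ (IsOutput.to out v))) ≡ lab h v
        labels v = sym (nodeHolds⇒label _ _ _ (IsOutput.lab-pres out v))
      from : h ≅ dgr L → IsOutput M g η h
      from h≅ = record
        { bij       = ↔-trans f (↔-sym β)
        ; lab-pres  = λ v → subst (T ∘ nodeHolds M g η _ _) (label≡ v) (holds (↔.from β (↔.to f v)))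
        ; edge-pres = λ v t w →
            let ((c , u) , _) = ↔.from β (↔.to f v) ; ((c′ , u′) , _) = ↔.from β (↔.to f w)
            in trans (discrete v t w) (sym (noEdges c c′ t u u′)) }
        where
        h≅⇔ = ⇔.to (≅dgr⇔ {L = L}) h≅
        discrete = proj₁ h≅⇔
        open Enumeration (proj₂ h≅⇔) renaming (bij to f)
        label≡ : ∀ v → label (proj₁ (proj₁ (↔.from β (↔.to f v)))) ≡ lab h v
        label≡ v = begin
          label (proj₁ (proj₁ (↔.from β (↔.to f v))))
            ≡⟨ β-labelled _ ⟨
          lookup L (↔.to β (↔.from β (↔.to f v)))
            ≡⟨ cong (lookup L) (↔.strictlyInverseˡ β (↔.to f v)) ⟩
          lookup L (↔.to f v)
            ≡⟨ labelled v ⟩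
          lab h v
            ∎
          where open ≡-Reasoning
        holds : ∀ (o : OutNode M g η) → let (c , u) = proj₁ o in T (nodeHolds M g η c u (label c))
        holds ((c , u) , out) = subst T (trans (isOutNode-M c u) (sym (nodeHolds-label c u))) out

    module _ {Y₁ : Fin p₁ → X → Bool} {Y₂ : Fin p₂ → X → Bool}
             {S₁ : Fin c₁ × X → Bool} {S₂ : Fin c₂ × X → Bool}
             (ηY₁ : ∀ X u → η (param₁ X) u ≡ Y₁ X u) (ηY₂ : ∀ X u → η (param₂ X) u ≡ Y₂ X u)
             (ηS₁ : ∀ c u → η (cutVar₁ c) u ≡ S₁ (c , u)) (ηS₂ : ∀ c u → η (cutVar₂ c) u ≡ S₂ (c , u))
             (ρ : Fin 0 → X) where

      T-dom : T (eval (dom M) g ρ η) ⇔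
              (T (eval (dom M₁) g ρ Y₁) × T (eval (dom M₂) g ρ Y₂) ×
               OutputCut M₁ g Y₁ a S₁ × OutputCut M₂ g Y₂ b S₂)
      T-dom = mk⇔
        (λ p → let (doms , cuts) = ⇔.to T-∧ p
                   (dom₁ , dom₂) = ⇔.to T-∧ doms
                   (cut₁ , cut₂) = ⇔.to T-∧ cuts
               in subst T (eval-dom₁) dom₁ , subst T (eval-dom₂) dom₂ ,
                  ⇔.to (Cut₁.T-cutFormula g ηY₁ ηS₁ ρ a) cut₁ ,
                  ⇔.to (Cut₂.T-cutFormula g ηY₂ ηS₂ ρ b) cut₂)
        (λ (dom₁ , dom₂ , cut₁ , cut₂) →
           ⇔.from T-∧ (⇔.from T-∧ (subst T (sym eval-dom₁) dom₁ , subst T (sym eval-dom₂) dom₂) ,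
                       ⇔.from T-∧ (⇔.from (Cut₁.T-cutFormula g ηY₁ ηS₁ ρ a) cut₁ ,
                                   ⇔.from (Cut₂.T-cutFormula g ηY₂ ηS₂ ρ b) cut₂)))
        where
        eval-dom₁ : eval (ren id param₁ (dom M₁)) g ρ η ≡ eval (dom M₁) g ρ Y₁
        eval-dom₁ = eval-ren (dom M₁) g id param₁ (λ ()) ηY₁
        eval-dom₂ : eval (ren id param₂ (dom M₂)) g ρ η ≡ eval (dom M₂) g ρ Y₂
        eval-dom₂ = eval-ren (dom M₂) g id param₂ (λ ()) ηY₂

  M-discrete : GraphToDGraph M
  M-discrete g h (η , _ , out) = output-discrete g η out

  Spec : Graph σ₁ γ₁ → Graph d e → Set
  Spec g h = ∃ λ m → ∃ λ n → m ≥ 1 × n ≥ 1 × h ≅ dgr (replicate m a ++ replicate n b) ×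
               (∃ λ h₁ → ∃ λ h₂ → h₁ ∈⟦ M₁ ⟧ g × h₂ ∈⟦ M₂ ⟧ g × StrLetter h₁ m a × StrLetter h₂ n b)

  sound : GraphToString M₁ → GraphToString M₂ → ∀ g h → h ∈⟦ M ⟧ g → Spec g h
  sound str₁ str₂ g h (η , domη , out) =
    let (dom₁ , dom₂ , cut₁ , cut₂) = ⇔.to (T-dom g η {S₁ = cutSet₁ g η} {S₂ = cutSet₂ g η}
                                             (λ _ _ → refl) (λ _ _ → refl) (λ _ _ → refl) (λ _ _ → refl) _) domη
        (m , m≥1 , f₁ , h₁ , h₁∈ , h₁/m≡a) = cut⇒letter M₁ str₁ dom₁ cut₁
        (n , n≥1 , f₂ , h₂ , h₂∈ , h₂/n≡b) = cut⇒letter M₂ str₂ dom₂ cut₂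
    in m , n , m≥1 , n≥1 , ⇔.to (output⇔dgr g η f₁ f₂) out , h₁ , h₂ , h₁∈ , h₂∈ , h₁/m≡a , h₂/n≡b

  module _ {X : Set} (Y₁ : Fin p₁ → X → Bool) (Y₂ : Fin p₂ → X → Bool)
           (S₁ : Fin c₁ × X → Bool) (S₂ : Fin c₂ × X → Bool) where

    valuation : Fin Params → X → Bool
    valuation = Y₁ ++ᶠ (Y₂ ++ᶠ (curry S₁ ++ᶠ curry S₂))

    valuation-param₁ : ∀ X u → valuation (param₁ X) u ≡ Y₁ X u
    valuation-param₁ X = cong-app (lookup-++ˡ Y₁ _ X)

    valuation-param₂ : ∀ X u → valuation (param₂ X) u ≡ Y₂ X u
    valuation-param₂ X = cong-app (trans (lookup-++ʳ Y₁ _ _) (lookup-++ˡ Y₂ _ X))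

    valuation-cutVar₁ : ∀ c u → valuation (cutVar₁ c) u ≡ S₁ (c , u)
    valuation-cutVar₁ c =
      cong-app (trans (lookup-++ʳ Y₁ _ _) (trans (lookup-++ʳ Y₂ _ _) (lookup-++ˡ (curry S₁) _ c)))

    valuation-cutVar₂ : ∀ c u → valuation (cutVar₂ c) u ≡ S₂ (c , u)
    valuation-cutVar₂ c =
      cong-app (trans (lookup-++ʳ Y₁ _ _) (trans (lookup-++ʳ Y₂ _ _) (lookup-++ʳ (curry S₁) _ c)))

  complete : ∀ g h → Spec g h → h ∈⟦ M ⟧ g
  complete g h (m , n , _ , _ , h≅ , h₁ , h₂ , h₁∈@(Y₁ , dom₁ , _) , h₂∈@(Y₂ , dom₂ , _) , h₁/m≡a , h₂/n≡b) =
    let (S₁ , cut₁ , f₁) = letter⇒cut M₁ h₁∈ h₁/m≡a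
        (S₂ , cut₂ , f₂) = letter⇒cut M₂ h₂∈ h₂/n≡b
        η = valuation Y₁ Y₂ S₁ S₂
        ηS₁ = valuation-cutVar₁ Y₁ Y₂ S₁ S₂
        ηS₂ = valuation-cutVar₂ Y₁ Y₂ S₁ S₂
    in η ,
       ⇔.from (T-dom g η (valuation-param₁ Y₁ Y₂ S₁ S₂) (valuation-param₂ Y₁ Y₂ S₁ S₂) ηS₁ ηS₂ _)
              (dom₁ , dom₂ , cut₁ , cut₂) ,
       ⇔.from (output⇔dgr g η (↔-trans (Sub-cong (uncurry ηS₁)) f₁) (↔-trans (Sub-cong (uncurry ηS₂)) f₂))
              h≅

lemma6 : ∀ {σ₁ γ₁ d : ℕ} (M₁ M₂ : Transducer σ₁ γ₁ 1 d) →
         GraphToString M₁ → GraphToString M₂ →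
         (a b : Fin d) → a ≢ b → (e : ℕ) →
         Σ (Transducer σ₁ γ₁ d e) λ M →
           GraphToDGraph M ×
           (∀ (g : Graph σ₁ γ₁) (h : Graph d e) →
             (h ∈⟦ M ⟧ g) ⇔
             (∃ λ m → ∃ λ n → m ≥ 1 × n ≥ 1 ×
                h ≅ dgr (replicate m a ++ replicate n b) ×
                (∃ λ h₁ → ∃ λ h₂ → h₁ ∈⟦ M₁ ⟧ g × h₂ ∈⟦ M₂ ⟧ g ×
                   StrLetter h₁ m a × StrLetter h₂ n b)))
lemma6 M₁ M₂ str₁ str₂ a b _ e = M , M-discrete , λ g h → mk⇔ (sound str₁ str₂ g h) (complete g h)
  where open Mᵃᵇ M₁ M₂ a b e
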